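{- Let $m\ge5$ be odd and write $m=2h+1$. Let $\Sigma=\{w(a,b):a,b\in\mathbb Z_m,\ a+b\neq0\}\subseteq A_m$, where $w(a,b)=(0,a,b,0,-a-b)$. For $w(a,b)\in\Sigma$ let $\ell(a,b)$ be the least positive integer $\ell$ with $G^{\ell}(w(a,b))\in\Sigma$, and define $\Phi(a,b)=(a',b')$ by $G^{\ell(a,b)}(w(a,b))=w(a',b')$. Write $s=a+b$, identified with its representative in $\{1,\dots,2h\}$. Then: (I) If $0\le b\le m-2$, then $b'=b+1$, $a'=a$ if $s=h$ and $a'=a+h$ if $s\ne h$; and \[ \ell(a,b)=\begin{cases}(h+1)m,&1\le s\le h-1,\\ 2(h+1)m,&s=h,\\ (3h+2)m,&h+1\le s\le 2h.\end{cases} \] (II) If $b=m-1$ (so $a\ne1$), then $\Phi(0,m-1)=(1,0)$ and $\Phi(a,m-1)=(a,0)$ for $a\ne0,1$; moreover $\ell(0,m-1)=m^3-(m-1)(m-2)$ and $\ell(a,m-1)=m-1$ for $a\neq0,1$.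
   Context: Indices in $\mathbb Z_5=\{0,\dots,4\}$. $A_m=\{w\in(\mathbb Z_m)^5:\sum_i w_i=0\}$; $e_i$ standard basis vectors; $q_i=e_i-e_4$ ($i=0,1,2,3$), $q_4=0$. For $w\in A_m$, $Z(w)=\{i:w_i=0\}$. The selector $p$ on zero-sets is: $p(\varnothing)=0$; $p(\{0\})=p(\{1\})=p(\{2\})=0$, $p(\{3\})=4$, $p(\{4\})=1$; $p(\{0,1\})=0$, $p(\{0,2\})=0$, $p(\{0,3\})=2$, $p(\{0,4\})=1$, $p(\{1,2\})=4$, $p(\{1,3\})=4$, $p(\{1,4\})=1$, $p(\{2,3\})=1$, $p(\{2,4\})=3$, $p(\{3,4\})=4$; $p(\{0,1,2\})=4$, $p(\{0,1,3\})=2$, $p(\{0,1,4\})=1$, $p(\{0,2,3\})=2$, $p(\{0,2,4\})=3$, $p(\{0,3,4\})=1$, $p(\{1,2,3\})=1$, $p(\{1,2,4\})=4$, $p(\{1,3,4\})=4$, $p(\{2,3,4\})=3$; $p(\{0,1,2,3,4\})=0$ (no point of $A_m$ has a four-element zero-set). The normalized return map is $G:A_m\to A_m$, $G(w)=w-3q_0+q_3+q_{p(Z(w))}$, i.e. $G(w)=w+(-3,0,0,1,1)+e_{p(Z(w))}$. Note $\Sigma=\{w\in A_m:p(Z(w))=2\}$. -}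

module Defs where

open import Data.Nat using (ℕ; zero; suc; _+_; _*_; _∸_; _<_; NonZero)
open import Data.Nat.DivMod using (_mod_)
open import Data.Fin using (Fin; toℕ) renaming (zero to f0; suc to fs)
open import Data.Bool using (Bool; true; false)
open import Data.Vec using (Vec; []; _∷_; map; zipWith)
open import Data.Product using (Σ; ∃; _×_)
open import Relation.Binary.PropositionalEquality using (_≡_)
open import Relation.Nullary using (¬_)
open import Function using (_∘_)

i0 i1 i2 i3 i4 : Fin 5
i0 = f0
i1 = fs f0
i2 = fs (fs f0)
i3 = fs (fs (fs f0))
i4 = fs (fs (fs (fs f0)))

module _ {m : ℕ} {{_ : NonZero m}} where

  addℕ : Fin m → ℕ → Fin m
  addℕ x k = (toℕ x + k) mod m

  _+ₘ_ : Fin m → Fin m → Fin m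
  x +ₘ y = addℕ x (toℕ y)

  -ₘ_ : Fin m → Fin m
  -ₘ x = (m ∸ toℕ x) mod m

  0ₘ : Fin m
  0ₘ = 0 mod m

  1ₘ : Fin m
  1ₘ = 1 mod m

  isZero : Fin m → Bool
  isZero x with toℕ x
  ... | zero  = true
  ... | suc _ = false

  Point : Set
  Point = Vec (Fin m) 5

  Z : Point → Vec Bool 5
  Z = map isZero

p : Vec Bool 5 → Fin 5
p (false ∷ false ∷ false ∷ false ∷ false ∷ []) = i0
p (true  ∷ false ∷ false ∷ false ∷ false ∷ []) = i0
p (false ∷ true  ∷ false ∷ false ∷ false ∷ []) = i0
p (false ∷ false ∷ true  ∷ false ∷ false ∷ []) = i0
p (false ∷ false ∷ false ∷ true  ∷ false ∷ []) = i4
p (false ∷ false ∷ false ∷ false ∷ true  ∷ []) = i1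
p (true  ∷ true  ∷ false ∷ false ∷ false ∷ []) = i0
p (true  ∷ false ∷ true  ∷ false ∷ false ∷ []) = i0
p (true  ∷ false ∷ false ∷ true  ∷ false ∷ []) = i2
p (true  ∷ false ∷ false ∷ false ∷ true  ∷ []) = i1
p (false ∷ true  ∷ true  ∷ false ∷ false ∷ []) = i4
p (false ∷ true  ∷ false ∷ true  ∷ false ∷ []) = i4
p (false ∷ true  ∷ false ∷ false ∷ true  ∷ []) = i1
p (false ∷ false ∷ true  ∷ true  ∷ false ∷ []) = i1
p (false ∷ false ∷ true  ∷ false ∷ true  ∷ []) = i3
p (false ∷ false ∷ false ∷ true  ∷ true  ∷ []) = i4
p (true  ∷ true  ∷ true  ∷ false ∷ false ∷ []) = i4
p (true  ∷ true  ∷ false ∷ true  ∷ false ∷ []) = i2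
p (true  ∷ true  ∷ false ∷ false ∷ true  ∷ []) = i1
p (true  ∷ false ∷ true  ∷ true  ∷ false ∷ []) = i2
p (true  ∷ false ∷ true  ∷ false ∷ true  ∷ []) = i3
p (true  ∷ false ∷ false ∷ true  ∷ true  ∷ []) = i1
p (false ∷ true  ∷ true  ∷ true  ∷ false ∷ []) = i1
p (false ∷ true  ∷ true  ∷ false ∷ true  ∷ []) = i4
p (false ∷ true  ∷ false ∷ true  ∷ true  ∷ []) = i4
p (false ∷ false ∷ true  ∷ true  ∷ true  ∷ []) = i3
p (true  ∷ true  ∷ true  ∷ true  ∷ true  ∷ []) = i0
-- four-element sets (do not occur on A_m)
p _ = i0

module _ {m : ℕ} {{_ : NonZero m}} where

  δ : {n : ℕ} → Fin n → Fin n → ℕ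
  δ f0 f0 = 1
  δ f0 (fs _) = 0
  δ (fs _) f0 = 0
  δ (fs i) (fs j) = δ i j

  -- G(w) = w + (-3,0,0,1,1) + e_{p(Z(w))}, with -3 represented by 3m - 3 (mod m)
  G : Point {m} → Point {m}
  G w = zipWith addℕ w
          ( (3 * m ∸ 3 + δ i0 j)
          ∷ δ i1 j
          ∷ δ i2 j
          ∷ (1 + δ i3 j)
          ∷ (1 + δ i4 j)
          ∷ [])
    where j = p (Z w)

  iterG : ℕ → Point {m} → Point {m}
  iterG zero w = w
  iterG (suc n) w = G (iterG n w)

  wpt : Fin m → Fin m → Point {m}
  wpt a b = 0ₘ ∷ a ∷ b ∷ 0ₘ ∷ (-ₘ (a +ₘ b)) ∷ []

  InΣ : Point {m} → Set
  InΣ w = Σ (Fin m) λ a → Σ (Fin m) λ b → ¬ (a +ₘ b ≡ 0ₘ) × (w ≡ wpt a b)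

  FirstReturn : ℕ → Point {m} → Point {m} → Set
  FirstReturn ℓ w w' =
    (0 < ℓ) × (iterG ℓ w ≡ w') × InΣ w' ×
    ((k : ℕ) → 0 < k → k < ℓ → ¬ InΣ (iterG k w))

-- A point of A_m is (x, v, c, y, z) with x ≡ -(v + c + y + z), so an orbit is followed through four
-- natural numbers read modulo m.  Off Σ the selector is mostly 0 and y, z just tick forward; the orbit
-- splits into laps of about m steps in which y runs once round ℤ_m, and it re-enters Σ at the first
-- lap end with x ≡ 0 ≢ z.
--
-- For b ≤ m - 2 the first step makes c = b + 1 ≢ 0, and a lap sends (v, z) to (v + 1, z + 1), to
-- (v, 0) from z = m - 1, or to (v + 1, 0) from x ≡ z ≡ 0.  Each advancing lap lowers x by 2, so,
-- m being odd, the lap at which x first vanishes is read off from s = a + b: this gives the three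
-- cases of (I).  For b = m - 1 the first step makes c ≡ 0 (lemmas marked ₀).  Then laps send (v, z)
-- to (v + 1, z - 1) keeping v + z, and (v, 1) to (v + 1, m - 1) lowering v + z by one.  From a ≥ 2
-- the orbit is back within one lap; from a = 0 it takes m - 2 rounds of m² + 1 steps, each lowering
-- v + z by one, after an initial stretch.

module Submission where

open import Defs
open import Data.Nat
  using (ℕ; zero; suc; pred; _+_; _*_; _∸_; _^_; _≤_; _<_; z≤n; s≤s; z<s; s<s; s≤s⁻¹; NonZero; >-nonZero; >-nonZero⁻¹)
open import Data.Nat.Properties
open import Data.Nat.DivMod
  using (_%_; _mod_; m%n<n; m%n%n≡m%n; %-distribˡ-+; %-distribˡ-*; [m+n]%n≡m%n; %-remove-+ʳ; m<n⇒m%n≡m)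
open import Data.Nat.Divisibility
  using (_∣_; _∤_; _∣?_; _∣0; ∣-refl; m%n≡0⇒n∣m; n∣m⇒m%n≡0; ∣m+n∣m⇒∣n; ∣m∣n⇒∣m+n; ∣n⇒∣m*n; n∣m*n; >⇒∤)
open import Data.Fin using (Fin; toℕ; fromℕ) renaming (zero to fzero; suc to fsuc)
open import Data.Fin.Properties using (toℕ-fromℕ; toℕ-fromℕ<; toℕ-injective; toℕ<n)
open import Data.Bool using (true; false)
open import Data.Vec using ([]; _∷_; lookup)
open import Data.Product using (_×_; _,_; proj₁; proj₂)
open import Data.Sum using (_⊎_; inj₁; inj₂)
import Data.Sum as Sum
open import Relation.Binary.PropositionalEquality
open import Relation.Nullary using (¬_; contradiction; yes; no)
open import Data.Nat.Tactic.RingSolver using (solve-∀)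
open import Function using (_∘_)
open import Level using (0ℓ)
open import Relation.Binary.Bundles using (Setoid)
import Relation.Binary.Reasoning.Setoid as SetoidReasoning

module Residues (m : ℕ) {{_ : NonZero m}} where

  ⟪_⟫ : ℕ → Fin m
  ⟪ n ⟫ = n mod m

  toℕ-⟪⟫ : ∀ n → toℕ ⟪ n ⟫ ≡ n % m
  toℕ-⟪⟫ n = toℕ-fromℕ< (m%n<n n m)

  ⟪toℕ⟫ : (x : Fin m) → ⟪ toℕ x ⟫ ≡ x
  ⟪toℕ⟫ x = toℕ-injective (trans (toℕ-⟪⟫ (toℕ x)) (m<n⇒m%n≡m (toℕ<n x)))

  0%m≡0 : 0 % m ≡ 0
  0%m≡0 = m<n⇒m%n≡m (>-nonZero⁻¹ m)

  0<n<m⇒m∤n : ∀ {n} → 0 < n → n < m → m ∤ n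
  0<n<m⇒m∤n 0<n n<m = >⇒∤ {{>-nonZero 0<n}} n<m

  isZero-⟪⟫-∣ : ∀ {n} → m ∣ n → isZero ⟪ n ⟫ ≡ true
  isZero-⟪⟫-∣ {n} m∣n with toℕ ⟪ n ⟫ in eq
  ... | zero  = refl
  ... | suc _ = contradiction (trans (sym eq) (trans (toℕ-⟪⟫ n) (n∣m⇒m%n≡0 n m m∣n))) λ ()

  isZero-⟪⟫-∤ : ∀ {n} → m ∤ n → isZero ⟪ n ⟫ ≡ false
  isZero-⟪⟫-∤ {n} m∤n with toℕ ⟪ n ⟫ in eq
  ... | zero  = contradiction (m%n≡0⇒n∣m n m (trans (sym (toℕ-⟪⟫ n)) eq)) m∤n
  ... | suc _ = refl

  -- Kept opaque so that unification sees a ≈ b rather than the unfolded remainders.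
  opaque
    infix 4 _≈_
    _≈_ : ℕ → ℕ → Set
    a ≈ b = a % m ≡ b % m

    ≡⇒≈ : ∀ {a b} → a ≡ b → a ≈ b
    ≡⇒≈ = cong (_% m)

    ≈-sym : ∀ {a b} → a ≈ b → b ≈ a
    ≈-sym = sym

    ≈-trans : ∀ {a b c} → a ≈ b → b ≈ c → a ≈ c
    ≈-trans = trans

    ⟪⟫-cong : ∀ {a b} → a ≈ b → ⟪ a ⟫ ≡ ⟪ b ⟫
    ⟪⟫-cong {a} {b} a≈b = toℕ-injective (trans (toℕ-⟪⟫ a) (trans a≈b (sym (toℕ-⟪⟫ b))))

    ⟪⟫-injective : ∀ {a b} → ⟪ a ⟫ ≡ ⟪ b ⟫ → a ≈ b
    ⟪⟫-injective {a} {b} eq = trans (sym (toℕ-⟪⟫ a)) (trans (cong toℕ eq) (toℕ-⟪⟫ b))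

    toℕ-⟪⟫≈ : ∀ n → toℕ ⟪ n ⟫ ≈ n
    toℕ-⟪⟫≈ n = trans (cong (_% m) (toℕ-⟪⟫ n)) (m%n%n≡m%n n m)

    +-≈ : ∀ {a a' b b'} → a ≈ a' → b ≈ b' → a + b ≈ a' + b'
    +-≈ {a} {a'} {b} {b'} a≈a' b≈b' = begin
      (a + b) % m             ≡⟨ %-distribˡ-+ a b m ⟩
      (a % m + b % m) % m     ≡⟨ cong₂ (λ s t → (s + t) % m) a≈a' b≈b' ⟩
      (a' % m + b' % m) % m   ≡⟨ %-distribˡ-+ a' b' m ⟨
      (a' + b') % m           ∎
      where open ≡-Reasoning

    *-≈ : ∀ k {a b} → a ≈ b → k * a ≈ k * b
    *-≈ k {a} {b} a≈b = begin
      (k * a) % m             ≡⟨ %-distribˡ-* k a m ⟩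
      (k % m * (a % m)) % m   ≡⟨ cong (λ t → (k % m * t) % m) a≈b ⟩
      (k % m * (b % m)) % m   ≡⟨ %-distribˡ-* k b m ⟨
      (k * b) % m             ∎
      where open ≡-Reasoning

    +m≈ : ∀ k → k + m ≈ k
    +m≈ k = [m+n]%n≡m%n k m

    ≈0⇒∣ : ∀ {n} → n ≈ 0 → m ∣ n
    ≈0⇒∣ {n} n≈0 = m%n≡0⇒n∣m n m (trans n≈0 0%m≡0)

    ∣⇒≈0 : ∀ {n} → m ∣ n → n ≈ 0
    ∣⇒≈0 {n} m∣n = trans (n∣m⇒m%n≡0 n m m∣n) (sym 0%m≡0)

    %≈ : ∀ n → n % m ≈ n
    %≈ n = m%n%n≡m%n n m

    ∣+≈ : ∀ a {n} → m ∣ n → a + n ≈ a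
    ∣+≈ a = %-remove-+ʳ a

  ≈-refl : ∀ {a} → a ≈ a
  ≈-refl = ≡⇒≈ refl

  ≈-setoid : Setoid 0ℓ 0ℓ
  ≈-setoid = record { Carrier = ℕ ; _≈_ = _≈_
                    ; isEquivalence = record { refl = ≈-refl ; sym = ≈-sym ; trans = ≈-trans } }

  module ≈-Reasoning = SetoidReasoning ≈-setoid

  ≈-∣ : ∀ {a b} → a ≈ b → m ∣ a → m ∣ b
  ≈-∣ a≈b m∣a = ≈0⇒∣ (≈-trans (≈-sym a≈b) (∣⇒≈0 m∣a))

  ≈-∤ : ∀ {a b} → a ≈ b → m ∤ a → m ∤ b
  ≈-∤ a≈b m∤a m∣b = m∤a (≈-∣ (≈-sym a≈b) m∣b)

  addℕ-⟪⟫ : ∀ n k → addℕ ⟪ n ⟫ k ≡ ⟪ n + k ⟫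
  addℕ-⟪⟫ n k = ⟪⟫-cong (+-≈ (toℕ-⟪⟫≈ n) ≈-refl)

  -ₘ-≡0ₘ : (x : Fin m) → -ₘ x ≡ 0ₘ → x ≡ 0ₘ
  -ₘ-≡0ₘ x -x≡0 with toℕ x in eq
  ... | zero  = toℕ-injective (trans eq (sym (trans (toℕ-⟪⟫ 0) 0%m≡0)))
  ... | suc k = contradiction (≈0⇒∣ (⟪⟫-injective -x≡0))
                              (0<n<m⇒m∤n (m<n⇒0<n∸m k<m) (∸-monoʳ-< z<s (<⇒≤ k<m)))
    where
    k<m : suc k < m
    k<m = subst (_< m) eq (toℕ<n x)

  +ₘ-⟪⟫ : ∀ a b → ⟪ a ⟫ +ₘ ⟪ b ⟫ ≡ ⟪ a + b ⟫
  +ₘ-⟪⟫ a b = trans (addℕ-⟪⟫ a (toℕ ⟪ b ⟫)) (⟪⟫-cong (+-≈ ≈-refl (toℕ-⟪⟫≈ b)))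

  ⟪⟫-neg : ∀ a z → m ∣ a + z → ⟪ z ⟫ ≡ -ₘ ⟪ a ⟫
  ⟪⟫-neg a z m∣a+z = trans (⟪⟫-cong z≈) (cong (λ t → ⟪ m ∸ t ⟫) (sym (toℕ-⟪⟫ a)))
    where
    z≈ : z ≈ m ∸ a % m
    z≈ = begin
      z                     ≈⟨ +m≈ z ⟨
      z + m                 ≡⟨ cong (z +_) (m∸n+n≡m (<⇒≤ (m%n<n a m))) ⟨
      z + (m ∸ r + r)       ≡⟨ shuffle z (m ∸ r) r ⟩
      m ∸ r + (r + z)       ≈⟨ +-≈ {m ∸ r} ≈-refl (+-≈ (%≈ a) ≈-refl) ⟩
      m ∸ r + (a + z)       ≈⟨ ∣+≈ (m ∸ r) m∣a+z ⟩
      m ∸ r                 ∎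
      where
      open ≈-Reasoning
      r : ℕ
      r = a % m
      shuffle : ∀ z d r → z + (d + r) ≡ d + (r + z)
      shuffle = solve-∀

module Orbit (h : ℕ) where

  m : ℕ
  m = suc (2 * h)

  open Residues m

  point : ℕ → ℕ → ℕ → ℕ → ℕ → Point {m}
  point x v c y z = ⟪ x ⟫ ∷ ⟪ v ⟫ ∷ ⟪ c ⟫ ∷ ⟪ y ⟫ ∷ ⟪ z ⟫ ∷ []

  point-cong : ∀ {x v c y z x' v' c' y' z'} → x ≈ x' → v ≈ v' → c ≈ c' → y ≈ y' → z ≈ z' →
               point x v c y z ≡ point x' v' c' y' z'
  point-cong ex ev ec ey ez =
    cong₂ _∷_ (⟪⟫-cong ex) (cong₂ _∷_ (⟪⟫-cong ev) (cong₂ _∷_ (⟪⟫-cong ec)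
      (cong₂ _∷_ (⟪⟫-cong ey) (cong₂ _∷_ (⟪⟫-cong ez) refl))))

  m∣S⇒m∣2hS : ∀ {S} → m ∣ S → m ∣ 2 * h * S
  m∣S⇒m∣2hS = ∣n⇒∣m*n (2 * h)

  m∣2hS⇒m∣S : ∀ {S} → m ∣ 2 * h * S → m ∣ S
  m∣2hS⇒m∣S {S} m∣2hS = ∣m+n∣m⇒∣n (subst (m ∣_) (2hS+S≡mS h S) (n∣m*n S)) m∣2hS
    where
    2hS+S≡mS : ∀ h S → S * suc (2 * h) ≡ 2 * h * S + S
    2hS+S≡mS = solve-∀

  3m∸3≡6h : 3 * m ∸ 3 ≡ 2 * h * 3
  3m∸3≡6h = trans (cong (_∸ 3) (3m≡6h+3 h)) (m+n∸n≡m (2 * h * 3) 3)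
    where
    3m≡6h+3 : ∀ h → 3 * suc (2 * h) ≡ 2 * h * 3 + 3
    3m≡6h+3 = solve-∀

  opaque
    -- x = -(v + c + y + z) since -1 ≡ 2h (mod m); opaque for the same reason as _≈_.
    pt : ℕ → ℕ → ℕ → ℕ → Point {m}
    pt v c y z = point (2 * h * (v + c + y + z)) v c y z

  selector : ℕ → ℕ → ℕ → ℕ → Fin 5
  selector v c y z = p (Z (pt v c y z))

  advance : Fin 5 → ℕ → ℕ → ℕ → ℕ → Point {m}
  advance fzero                             v c y z = pt v c (suc y) (suc z)
  advance (fsuc fzero)                      v c y z = pt (suc v) c (suc y) (suc z)
  advance (fsuc (fsuc fzero))               v c y z = pt v (suc c) (suc y) (suc z)
  advance (fsuc (fsuc (fsuc fzero)))        v c y z = pt v c (2 + y) (suc z)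
  advance (fsuc (fsuc (fsuc (fsuc fzero)))) v c y z = pt v c (suc y) (2 + z)

  opaque
    unfolding pt

    pt-cong : ∀ {v c y z v' c' y' z'} → v ≈ v' → c ≈ c' → y ≈ y' → z ≈ z' → pt v c y z ≡ pt v' c' y' z'
    pt-cong ev ec ey ez = point-cong (*-≈ (2 * h) (+-≈ (+-≈ (+-≈ ev ec) ey) ez)) ev ec ey ez

    G-pt : ∀ v c y z → G (pt v c y z) ≡ advance (selector v c y z) v c y z
    G-pt v c y z = trans G-point (shifted≡advance (selector v c y z))
      where
      S : ℕ
      S = v + c + y + z
      shifted : Fin 5 → Point {m}
      shifted j = point (2 * h * S + (3 * m ∸ 3 + δ {m} i0 j)) (v + δ {m} i1 j) (c + δ {m} i2 j)
                        (y + (1 + δ {m} i3 j)) (z + (1 + δ {m} i4 j))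
      G-point : G (pt v c y z) ≡ shifted (selector v c y z)
      G-point = cong₂ _∷_ (addℕ-⟪⟫ (2 * h * S) _) (cong₂ _∷_ (addℕ-⟪⟫ v _) (cong₂ _∷_ (addℕ-⟪⟫ c _)
                  (cong₂ _∷_ (addℕ-⟪⟫ y _) (cong₂ _∷_ (addℕ-⟪⟫ z _) refl))))
      swap : ∀ n k → n + k ≈ k + n
      swap n k = ≡⇒≈ (+-comm n k)
      2hS+6h : 2 * h * S + 2 * h * 3 ≡ 2 * h * (S + 3)
      2hS+6h = sym (*-distribˡ-+ (2 * h) S 3)
      x-drop : ∀ {S'} → S + 3 ≡ S' → 2 * h * S + (3 * m ∸ 3 + 0) ≈ 2 * h * S'
      x-drop e = ≡⇒≈ (trans (cong (2 * h * S +_) (trans (+-identityʳ _) 3m∸3≡6h)) (trans 2hS+6h (cong (2 * h *_) e)))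
      x-drop₀ : 2 * h * S + (3 * m ∸ 3 + 1) ≈ 2 * h * (v + c + suc y + suc z)
      x-drop₀ = ≈-trans (≡⇒≈ (trans (cong (λ t → 2 * h * S + (t + 1)) 3m∸3≡6h) (regroup h v c y z))) (+m≈ _)
        where
        regroup : ∀ h v c y z → 2 * h * (v + c + y + z) + (2 * h * 3 + 1) ≡ 2 * h * (v + c + suc y + suc z) + suc (2 * h)
        regroup = solve-∀
      sum₁ : ∀ v c y z → v + c + y + z + 3 ≡ suc v + c + suc y + suc z
      sum₁ = solve-∀
      sum₂ : ∀ v c y z → v + c + y + z + 3 ≡ v + suc c + suc y + suc z
      sum₂ = solve-∀
      sum₃ : ∀ v c y z → v + c + y + z + 3 ≡ v + c + (2 + y) + suc z
      sum₃ = solve-∀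
      sum₄ : ∀ v c y z → v + c + y + z + 3 ≡ v + c + suc y + (2 + z)
      sum₄ = solve-∀
      shifted≡advance : ∀ j → shifted j ≡ advance j v c y z
      shifted≡advance fzero =
        point-cong x-drop₀ (swap v 0) (swap c 0) (swap y 1) (swap z 1)
      shifted≡advance (fsuc fzero) =
        point-cong (x-drop (sum₁ v c y z)) (swap v 1) (swap c 0) (swap y 1) (swap z 1)
      shifted≡advance (fsuc (fsuc fzero)) =
        point-cong (x-drop (sum₂ v c y z)) (swap v 0) (swap c 1) (swap y 1) (swap z 1)
      shifted≡advance (fsuc (fsuc (fsuc fzero))) =
        point-cong (x-drop (sum₃ v c y z)) (swap v 0) (swap c 0) (swap y 2) (swap z 1)
      shifted≡advance (fsuc (fsuc (fsuc (fsuc fzero)))) =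
        point-cong (x-drop (sum₄ v c y z)) (swap v 0) (swap c 0) (swap y 1) (swap z 2)

    InΣ-pt : ∀ {v c y z} → InΣ (pt v c y z) → m ∣ y × m ∣ v + c + y + z × m ∤ z
    InΣ-pt {v} {c} {y} {z} (a , b , a+b≢0 , eq) = m∣y , m∣S , m∤z
      where
      m∣y : m ∣ y
      m∣y = ≈0⇒∣ (⟪⟫-injective (cong (λ w → lookup w i3) eq))
      m∣S : m ∣ v + c + y + z
      m∣S = m∣2hS⇒m∣S (≈0⇒∣ (⟪⟫-injective (cong (λ w → lookup w i0) eq)))
      m∤z : m ∤ z
      m∤z m∣z = a+b≢0 (-ₘ-≡0ₘ (a +ₘ b) (trans (sym (cong (λ w → lookup w i4) eq)) (⟪⟫-cong (∣⇒≈0 m∣z))))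

    pt≡wpt : ∀ {v c z} → m ∣ v + c + z → pt v c 0 z ≡ wpt ⟪ v ⟫ ⟪ c ⟫
    pt≡wpt {v} {c} {z} m∣S =
      cong₂ _∷_ x≡0 (cong₂ _∷_ refl (cong₂ _∷_ refl (cong₂ _∷_ refl (cong₂ _∷_ z≡ refl))))
      where
      x≡0 : ⟪ 2 * h * (v + c + 0 + z) ⟫ ≡ 0ₘ
      x≡0 = ⟪⟫-cong (∣⇒≈0 (m∣S⇒m∣2hS (subst (m ∣_) (cong (_+ z) (sym (+-identityʳ (v + c)))) m∣S)))
      z≡ : ⟪ z ⟫ ≡ -ₘ (⟪ v ⟫ +ₘ ⟪ c ⟫)
      z≡ = trans (⟪⟫-neg (v + c) z m∣S) (cong -ₘ_ (sym (+ₘ-⟪⟫ v c)))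

    selector-flags : ∀ {v c y z b₀ b₁ b₂ b₃ b₄} →
      isZero ⟪ 2 * h * (v + c + y + z) ⟫ ≡ b₀ → isZero ⟪ v ⟫ ≡ b₁ → isZero ⟪ c ⟫ ≡ b₂ →
      isZero ⟪ y ⟫ ≡ b₃ → isZero ⟪ z ⟫ ≡ b₄ →
      selector v c y z ≡ p (b₀ ∷ b₁ ∷ b₂ ∷ b₃ ∷ b₄ ∷ [])
    selector-flags refl refl refl refl refl = refl

  ∉Σ-y : ∀ {v c y z} → m ∤ y → ¬ InΣ (pt v c y z)
  ∉Σ-y m∤y w∈Σ = m∤y (proj₁ (InΣ-pt w∈Σ))

  ∉Σ-x : ∀ {v c y z} → m ∤ v + c + y + z → ¬ InΣ (pt v c y z)
  ∉Σ-x m∤S w∈Σ = m∤S (proj₁ (proj₂ (InΣ-pt w∈Σ)))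

  ∉Σ-z : ∀ {v c y z} → m ∣ z → ¬ InΣ (pt v c y z)
  ∉Σ-z m∣z w∈Σ = proj₂ (proj₂ (InΣ-pt w∈Σ)) m∣z

  wpt-nonzero : ∀ {v c z} → m ∣ v + c + z → m ∤ z → ¬ (⟪ v ⟫ +ₘ ⟪ c ⟫ ≡ 0ₘ)
  wpt-nonzero {v} {c} m∣S m∤z v+c≡0 =
    m∤z (∣m+n∣m⇒∣n m∣S (≈0⇒∣ (⟪⟫-injective (trans (sym (+ₘ-⟪⟫ v c)) v+c≡0))))

  infix 4 _↝⟨_⟩_
  data _↝⟨_⟩_ : Point {m} → ℕ → Point {m} → Set where
    stay  : ∀ {w} → w ↝⟨ 0 ⟩ w
    leave : ∀ {w k w'} → ¬ InΣ {m} w → G {m} w ↝⟨ k ⟩ w' → w ↝⟨ suc k ⟩ w'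

  infixr 5 _▸_
  _▸_ : ∀ {w₁ w₂ w₃ a b} → w₁ ↝⟨ a ⟩ w₂ → w₂ ↝⟨ b ⟩ w₃ → w₁ ↝⟨ a + b ⟩ w₃
  stay        ▸ r = r
  leave w∉ r₁ ▸ r = leave w∉ (r₁ ▸ r)

  infixl 6 _▹_
  _▹_ : ∀ {w w' w'' k} → w ↝⟨ k ⟩ w' → w' ≡ w'' → w ↝⟨ k ⟩ w''
  r ▹ refl = r

  ↝-length : ∀ {w w' k k'} → k ≡ k' → w ↝⟨ k ⟩ w' → w ↝⟨ k' ⟩ w'
  ↝-length refl r = r

  iterG-suc : ∀ k w → iterG {m} (suc k) w ≡ iterG {m} k (G {m} w)
  iterG-suc zero    w = refl
  iterG-suc (suc k) w = cong (G {m}) (iterG-suc k w)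

  ↝-iterG : ∀ {w k w'} → w ↝⟨ k ⟩ w' → iterG {m} k w ≡ w'
  ↝-iterG stay                    = refl
  ↝-iterG {w} (leave {k = k} _ r) = trans (iterG-suc k w) (↝-iterG r)

  ↝-avoids : ∀ {w k w'} → w ↝⟨ k ⟩ w' → ∀ i → i < k → ¬ InΣ {m} (iterG {m} i w)
  ↝-avoids (leave w∉ r) zero    _         = w∉
  ↝-avoids {w} (leave _ r) (suc i) (s<s i<k) = ↝-avoids r i i<k ∘ subst (InΣ {m}) (iterG-suc i w)

  firstReturn : ∀ {w v c z ℓ} → m ∣ v + c + z → m ∤ z → G {m} w ↝⟨ ℓ ⟩ pt v c 0 z →
                FirstReturn {m} (suc ℓ) w (wpt ⟪ v ⟫ ⟪ c ⟫)
  firstReturn {w} {v} {c} {z} {ℓ} m∣S m∤z r =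
    z<s , trans (iterG-suc ℓ w) (trans (↝-iterG r) (pt≡wpt {v} {c} {z} m∣S)) ,
    (⟪ v ⟫ , ⟪ c ⟫ , wpt-nonzero {v} {c} {z} m∣S m∤z , refl) , minimal
    where
    minimal : ∀ i → 0 < i → i < suc ℓ → ¬ InΣ {m} (iterG {m} i w)
    minimal (suc i) _ (s<s i<ℓ) = ↝-avoids r i i<ℓ ∘ subst (InΣ {m}) (iterG-suc i w)

  x-flag-∣ : ∀ {S} → m ∣ S → isZero ⟪ 2 * h * S ⟫ ≡ true
  x-flag-∣ = isZero-⟪⟫-∣ ∘ m∣S⇒m∣2hS

  x-flag-∤ : ∀ {S} → m ∤ S → isZero ⟪ 2 * h * S ⟫ ≡ false
  x-flag-∤ m∤S = isZero-⟪⟫-∤ (m∤S ∘ m∣2hS⇒m∣S)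

  sum-y0 : ∀ v c z → v + c + 0 + z ≡ v + c + z
  sum-y0 v c z = cong (_+ z) (+-identityʳ (v + c))

  step : ∀ {v c y z j} → selector v c y z ≡ j → ¬ InΣ {m} (pt v c y z) → pt v c y z ↝⟨ 1 ⟩ advance j v c y z
  step {v} {c} {y} {z} sel w∉ = leave w∉ (stay ▹ trans (G-pt v c y z) (cong (λ j → advance j v c y z) sel))

  drift-step : ∀ {v c y z} → m ∤ y → m ∤ z → m ∤ v ⊎ m ∤ c → pt v c y z ↝⟨ 1 ⟩ pt v c (suc y) (suc z)
  drift-step {v} {c} {y} {z} m∤y m∤z v∨c =
    step (trans (selector-flags refl refl refl (isZero-⟪⟫-∤ m∤y) (isZero-⟪⟫-∤ m∤z)) (table _ _ _ flags))
         (∉Σ-y m∤y)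
    where
    flags : isZero ⟪ v ⟫ ≡ false ⊎ isZero ⟪ c ⟫ ≡ false
    flags = Sum.map isZero-⟪⟫-∤ isZero-⟪⟫-∤ v∨c
    table : ∀ b₀ b₁ b₂ → b₁ ≡ false ⊎ b₂ ≡ false → p (b₀ ∷ b₁ ∷ b₂ ∷ false ∷ false ∷ []) ≡ i0
    table false false false _ = refl
    table false false true  _ = refl
    table false true  false _ = refl
    table true  false false _ = refl
    table true  false true  _ = refl
    table true  true  false _ = refl
    table _     true  true  (inj₁ ())
    table _     true  true  (inj₂ ())

  z-wrap-step : ∀ {v c y z} → m ∤ y → m ∣ z → m ∤ c → pt v c y z ↝⟨ 1 ⟩ pt (suc v) c (suc y) (suc z)
  z-wrap-step m∤y m∣z m∤c =
    step (trans (selector-flags refl refl (isZero-⟪⟫-∤ m∤c) (isZero-⟪⟫-∤ m∤y) (isZero-⟪⟫-∣ m∣z)) (table _ _))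
         (∉Σ-y m∤y)
    where
    table : ∀ b₀ b₁ → p (b₀ ∷ b₁ ∷ false ∷ false ∷ true ∷ []) ≡ i1
    table false false = refl
    table false true  = refl
    table true  false = refl
    table true  true  = refl

  y-wrap-step : ∀ {v c z} → m ∤ v + c + z → m ∤ c → pt v c 0 z ↝⟨ 1 ⟩ pt v c 1 (2 + z)
  y-wrap-step {v} {c} {z} m∤S m∤c =
    step (trans (selector-flags (x-flag-∤ m∤S') refl (isZero-⟪⟫-∤ m∤c) refl refl) (table _ _)) (∉Σ-x m∤S')
    where
    m∤S' : m ∤ v + c + 0 + z
    m∤S' = m∤S ∘ subst (m ∣_) (sum-y0 v c z)
    table : ∀ b₁ b₄ → p (false ∷ b₁ ∷ false ∷ true ∷ b₄ ∷ []) ≡ i4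
    table false false = refl
    table false true  = refl
    table true  false = refl
    table true  true  = refl

  zero-lap-step : ∀ {v c} → m ∣ v + c → m ∤ c → pt v c 0 0 ↝⟨ 1 ⟩ pt (suc v) c 1 1
  zero-lap-step {v} {c} m∣v+c m∤c =
    step (selector-flags (x-flag-∣ m∣S) (isZero-⟪⟫-∤ m∤v) (isZero-⟪⟫-∤ m∤c) refl refl) (∉Σ-z (m ∣0))
    where
    m∣S : m ∣ v + c + 0 + 0
    m∣S = subst (m ∣_) (sym (trans (+-identityʳ _) (+-identityʳ _))) m∣v+c
    m∤v : m ∤ v
    m∤v m∣v = m∤c (∣m+n∣m⇒∣n m∣v+c m∣v)

  exit-step : ∀ {v c z} → m ∣ v + c + z → m ∤ z → G {m} (pt v c 0 z) ≡ pt v (suc c) 1 (suc z)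
  exit-step {v} {c} {z} m∣S m∤z =
    trans (G-pt v c 0 z) (cong (λ j → advance j v c 0 z)
      (trans (selector-flags (x-flag-∣ m∣S') refl refl refl (isZero-⟪⟫-∤ m∤z)) (table _ _ flags)))
    where
    m∣S' : m ∣ v + c + 0 + z
    m∣S' = subst (m ∣_) (sym (sum-y0 v c z)) m∣S
    m∤v⊎m∤c : m ∤ v ⊎ m ∤ c
    m∤v⊎m∤c with m ∣? v
    ... | no m∤v  = inj₁ m∤v
    ... | yes m∣v = inj₂ λ m∣c → m∤z (∣m+n∣m⇒∣n m∣S (∣m∣n⇒∣m+n m∣v m∣c))
    flags : isZero ⟪ v ⟫ ≡ false ⊎ isZero ⟪ c ⟫ ≡ false
    flags = Sum.map isZero-⟪⟫-∤ isZero-⟪⟫-∤ m∤v⊎m∤c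
    table : ∀ b₁ b₂ → b₁ ≡ false ⊎ b₂ ≡ false → p (true ∷ b₁ ∷ b₂ ∷ true ∷ false ∷ []) ≡ i2
    table false false _ = refl
    table false true  _ = refl
    table true  false _ = refl
    table true  true  (inj₁ ())
    table true  true  (inj₂ ())

  y-wrap-step₀ : ∀ {v z} → m ∤ v + z → m ∤ z → pt v 0 0 z ↝⟨ 1 ⟩ pt (suc v) 0 1 (suc z)
  y-wrap-step₀ {v} {z} m∤S m∤z =
    step (trans (selector-flags (x-flag-∤ m∤S') refl refl refl (isZero-⟪⟫-∤ m∤z)) (table _)) (∉Σ-x m∤S')
    where
    m∤S' : m ∤ v + 0 + 0 + z
    m∤S' = m∤S ∘ subst (m ∣_) (trans (sum-y0 v 0 z) (cong (_+ z) (+-identityʳ v)))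
    table : ∀ b₁ → p (false ∷ b₁ ∷ true ∷ true ∷ false ∷ []) ≡ i1
    table false = refl
    table true  = refl

  z-wrap-step₀ : ∀ {v y z} → m ∤ y → m ∣ z → m ∤ v → pt v 0 y z ↝⟨ 1 ⟩ pt v 0 (2 + y) (suc z)
  z-wrap-step₀ m∤y m∣z m∤v =
    step (trans (selector-flags refl (isZero-⟪⟫-∤ m∤v) refl (isZero-⟪⟫-∤ m∤y) (isZero-⟪⟫-∣ m∣z)) (table _))
         (∉Σ-y m∤y)
    where
    table : ∀ b₀ → p (b₀ ∷ false ∷ true ∷ false ∷ true ∷ []) ≡ i3
    table false = refl
    table true  = refl

  yz-wrap-step₀ : ∀ {v} → m ∤ v → pt v 0 0 0 ↝⟨ 1 ⟩ pt v 0 2 1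
  yz-wrap-step₀ {v} m∤v =
    step (selector-flags (x-flag-∤ m∤S) (isZero-⟪⟫-∤ m∤v) refl refl refl) (∉Σ-z (m ∣0))
    where
    m∤S : m ∤ v + 0 + 0 + 0
    m∤S = m∤v ∘ subst (m ∣_) (trans (+-identityʳ _) (trans (+-identityʳ _) (+-identityʳ v)))

  drift₄-step : ∀ {y z} → m ∤ y → pt 0 0 y z ↝⟨ 1 ⟩ pt 0 0 (suc y) (2 + z)
  drift₄-step {y} {z} m∤y =
    step (trans (selector-flags refl refl refl (isZero-⟪⟫-∤ m∤y) refl) (table _ _ flags)) (∉Σ-y m∤y)
    where
    flags : isZero ⟪ 2 * h * (y + z) ⟫ ≡ false ⊎ isZero ⟪ z ⟫ ≡ false
    flags with m ∣? z
    ... | no m∤z  = inj₂ (isZero-⟪⟫-∤ m∤z)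
    ... | yes m∣z = inj₁ (x-flag-∤ λ m∣y+z → m∤y (∣m+n∣m⇒∣n (subst (m ∣_) (+-comm y z) m∣y+z) m∣z))
    table : ∀ b₀ b₄ → b₀ ≡ false ⊎ b₄ ≡ false → p (b₀ ∷ true ∷ true ∷ false ∷ b₄ ∷ []) ≡ i4
    table false false _ = refl
    table false true  _ = refl
    table true  false _ = refl
    table true  true  (inj₁ ())
    table true  true  (inj₂ ())

  null-step : pt 0 0 0 0 ↝⟨ 1 ⟩ pt 0 0 1 1
  null-step = step (selector-flags (x-flag-∣ (m ∣0)) refl refl refl refl) (∉Σ-z (m ∣0))

  drift : ∀ k {v c y z} → 0 < y → 0 < z → y + k ≤ m → z + k ≤ m → m ∤ v ⊎ m ∤ c →
          pt v c y z ↝⟨ k ⟩ pt v c (y + k) (z + k)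
  drift zero {v} {c} {y} {z} _ _ _ _ _ = stay ▹ cong₂ (pt v c) (sym (+-identityʳ y)) (sym (+-identityʳ z))
  drift (suc k) {v} {c} {y} {z} 0<y 0<z y+k≤m z+k≤m v∨c =
    drift-step (0<n<m⇒m∤n 0<y (below y+k≤m)) (0<n<m⇒m∤n 0<z (below z+k≤m)) v∨c
    ▸ drift k z<s z<s (subst (_≤ m) (+-suc y k) y+k≤m) (subst (_≤ m) (+-suc z k) z+k≤m) v∨c
        ▹ cong₂ (pt v c) (sym (+-suc y k)) (sym (+-suc z k))
    where
    below : ∀ {n} → n + suc k ≤ m → n < m
    below {n} = <-≤-trans (m<m+n n z<s)

  drift₄ : ∀ k {y z} → 0 < y → y + k ≤ m → pt 0 0 y z ↝⟨ k ⟩ pt 0 0 (y + k) (z + 2 * k)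
  drift₄ zero {y} {z} _ _ = stay ▹ cong₂ (pt 0 0) (sym (+-identityʳ y)) (sym (z+2*0 z))
    where
    z+2*0 : ∀ z → z + 2 * 0 ≡ z
    z+2*0 = solve-∀
  drift₄ (suc k) {y} {z} 0<y y+k≤m =
    drift₄-step (0<n<m⇒m∤n 0<y (<-≤-trans (m<m+n y z<s) y+k≤m))
    ▸ drift₄ k z<s (subst (_≤ m) (+-suc y k) y+k≤m) ▹ cong₂ (pt 0 0) (sym (+-suc y k)) (z-shift z k)
    where
    z-shift : ∀ z k → 2 + z + 2 * k ≡ z + 2 * suc k
    z-shift = solve-∀

  m≈0 : m ≈ 0
  m≈0 = +m≈ 0

  ≡m⇒≈0 : ∀ {n} → n ≡ m → n ≈ 0
  ≡m⇒≈0 refl = m≈0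

  tail : ∀ {v c t} → 0 < t → t < m → m ∤ c → pt v c 1 (suc t) ↝⟨ 2 * h ⟩ pt (suc v) c 0 t
  tail {v} {c} {suc t} _ t<m m∤c with m≤n⇒∃[o]m+o≡n (s≤s⁻¹ t<m)
  ... | r , t+r≡2h = ↝-length (trans (+-comm r (suc t)) t+r≡2h)
      ( drift r z<s z<s (s≤s (m+n≤o⇒n≤o (suc t) (≤-reflexive t+r≡2h))) (≤-reflexive (cong suc t+r≡2h)) (inj₂ m∤c)
          ▹ cong (pt v c (1 + r)) (cong suc t+r≡2h)
      ▸ z-wrap-step (0<n<m⇒m∤n z<s (s≤s (≤-trans (s≤s (m≤n+m r t)) (≤-reflexive t+r≡2h)))) ∣-refl m∤c
          ▹ pt-cong ≈-refl ≈-refl ≈-refl (+m≈ 1)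
      ▸ drift t z<s z<s (≤-reflexive y-end) (s≤s (m+n≤o⇒m≤o t (≤-trans (n≤1+n _) (≤-reflexive t+r≡2h))))
              (inj₂ m∤c)
          ▹ pt-cong ≈-refl ≈-refl (≡m⇒≈0 y-end) ≈-refl )
    where
    y-end : 2 + r + t ≡ m
    y-end = cong suc (trans (cong suc (+-comm r t)) t+r≡2h)

  lap-advance : ∀ {v c z} → 2 + z ≤ m → m ∤ v + c + z → m ∤ c → pt v c 0 z ↝⟨ m ⟩ pt (suc v) c 0 (suc z)
  lap-advance 2+z≤m m∤S m∤c = y-wrap-step m∤S m∤c ▸ tail z<s 2+z≤m m∤c

  lap-reset : ∀ {v c} → m ∤ v + c + 2 * h → m ∤ c → pt v c 0 (2 * h) ↝⟨ m ⟩ pt v c 0 0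
  lap-reset m∤S m∤c =
    y-wrap-step m∤S m∤c ▹ pt-cong ≈-refl ≈-refl ≈-refl (+m≈ 1)
    ▸ drift (2 * h) z<s z<s ≤-refl ≤-refl (inj₂ m∤c) ▹ pt-cong ≈-refl ≈-refl m≈0 m≈0

  lap-zero : ∀ {v c} → m ∣ v + c → m ∤ c → pt v c 0 0 ↝⟨ m ⟩ pt (suc v) c 0 0
  lap-zero m∣v+c m∤c =
    zero-lap-step m∣v+c m∤c
    ▸ drift (2 * h) z<s z<s ≤-refl ≤-refl (inj₂ m∤c) ▹ pt-cong ≈-refl ≈-refl m≈0 m≈0

  laps-advance : ∀ n {v c z} → z + n < m → (∀ i → i < n → m ∤ v + c + z + 2 * i) → m ∤ c →
                 pt v c 0 z ↝⟨ n * m ⟩ pt (v + n) c 0 (z + n)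
  laps-advance zero {v} {c} {z} _ _ _ = stay ▹ cong₂ (λ v' z' → pt v' c 0 z') (sym (+-identityʳ v)) (sym (+-identityʳ z))
  laps-advance (suc n) {v} {c} {z} z+n<m m∤S m∤c =
    lap-advance (≤-trans (s≤s (s≤s (m≤m+n z n))) (subst (_< m) (+-suc z n) z+n<m))
                (m∤S 0 z<s ∘ subst (m ∣_) (sym (+-identityʳ _))) m∤c
    ▸ laps-advance n (subst (_< m) (+-suc z n) z+n<m) (λ i i<n → m∤S (suc i) (s<s i<n) ∘ subst (m ∣_) (shift v c z i)) m∤c
      ▹ cong₂ (λ v' z' → pt v' c 0 z') (sym (+-suc v n)) (sym (+-suc z n))
    where
    shift : ∀ v c z i → suc v + c + suc z + 2 * i ≡ v + c + z + 2 * suc i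
    shift = solve-∀

  tail₀ : ∀ {u t ℓ} → suc ℓ ≡ 2 * h → 0 < t → 2 + t ≤ m → m ∤ u → pt u 0 1 (2 + t) ↝⟨ ℓ ⟩ pt u 0 0 t
  tail₀ {u} {suc t} {ℓ} 1+ℓ≡2h _ 2+t≤m m∤u with m≤n⇒∃[o]m+o≡n 2+t≤m
  ... | r , 2+t+r≡m = ↝-length length
      ( drift r z<s z<s (≤-trans (s≤s (m≤n+m r (2 + t))) (≤-reflexive 2+t+r≡m)) (≤-reflexive 2+t+r≡m) (inj₁ m∤u)
          ▹ cong (pt u 0 (1 + r)) 2+t+r≡m
      ▸ z-wrap-step₀ (0<n<m⇒m∤n z<s (≤-trans (s≤s (s≤s (m≤n+m r (suc t)))) (≤-reflexive 2+t+r≡m))) ∣-refl m∤u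
          ▹ pt-cong ≈-refl ≈-refl ≈-refl (+m≈ 1)
      ▸ drift t z<s z<s (≤-reflexive y-end) (≤-trans (s≤s (m≤n+m t 2)) 2+t≤m) (inj₁ m∤u)
          ▹ pt-cong ≈-refl ≈-refl (≡m⇒≈0 y-end) ≈-refl )
    where
    y-end : 2 + (1 + r) + t ≡ m
    y-end = trans (cong (3 +_) (+-comm r t)) 2+t+r≡m
    length : r + (1 + t) ≡ ℓ
    length = suc-injective (suc-injective (trans (regroup r t) (trans 2+t+r≡m (cong suc (sym 1+ℓ≡2h)))))
      where
      regroup : ∀ r t → 2 + (r + (1 + t)) ≡ 2 + suc t + r
      regroup = solve-∀

  lap₀-advance : ∀ {v t} → 0 < t → 2 + t ≤ m → suc v < m → m ∤ v + suc t →
                 pt v 0 0 (suc t) ↝⟨ 2 * h ⟩ pt (suc v) 0 0 t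
  lap₀-advance 0<t 2+t≤m 1+v<m m∤S
    with m≤n⇒∃[o]m+o≡n (m+n≤o⇒m≤o 1 (s≤s⁻¹ (≤-trans (s≤s (s≤s 0<t)) 2+t≤m)))
  ... | ℓ , 1+ℓ≡2h = ↝-length 1+ℓ≡2h
      (y-wrap-step₀ m∤S (0<n<m⇒m∤n z<s 2+t≤m) ▸ tail₀ 1+ℓ≡2h 0<t 2+t≤m (0<n<m⇒m∤n z<s 1+v<m))

  lap₀-carry : ∀ {t} → 0 < t → 2 + t ≤ m → pt (2 * h) 0 0 (suc t) ↝⟨ m ⟩ pt 0 0 0 t
  lap₀-carry {t} 0<t 2+t≤m =
    y-wrap-step₀ (≈-∤ (≈-sym (≈-trans (≡⇒≈ (2h+1+t≡t+m h t)) (+m≈ t)))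
                      (0<n<m⇒m∤n 0<t (<-trans (n<1+n t) 2+t≤m)))
                 (0<n<m⇒m∤n z<s 2+t≤m)
      ▹ pt-cong m≈0 ≈-refl ≈-refl ≈-refl
    ▸ drift₄ (2 * h) z<s ≤-refl
      ▹ pt-cong ≈-refl ≈-refl m≈0 (≈-trans (≡⇒≈ (2+t+4h≡t+m+m h t)) (≈-trans (+m≈ (t + m)) (+m≈ t)))
    where
    2h+1+t≡t+m : ∀ h t → 2 * h + suc t ≡ t + suc (2 * h)
    2h+1+t≡t+m = solve-∀
    2+t+4h≡t+m+m : ∀ h t → 2 + t + 2 * (2 * h) ≡ t + suc (2 * h) + suc (2 * h)
    2+t+4h≡t+m+m = solve-∀

  laps₀-advance : ∀ n {v t} → 0 < t → n + t < m → v + n < m → m ∤ v + (n + t) →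
                  pt v 0 0 (n + t) ↝⟨ n * (2 * h) ⟩ pt (v + n) 0 0 t
  laps₀-advance zero {v} {t} _ _ _ _ = stay ▹ cong (λ v' → pt v' 0 0 t) (sym (+-identityʳ v))
  laps₀-advance (suc n) {v} {t} 0<t n+t<m v+n<m m∤S =
    lap₀-advance (≤-trans 0<t (m≤n+m t n)) n+t<m (≤-trans (s≤s (s≤s (m≤m+n v n))) (subst (_< m) (+-suc v n) v+n<m)) m∤S
    ▸ laps₀-advance n 0<t (<-trans (n<1+n _) n+t<m) (subst (_< m) (+-suc v n) v+n<m)
                    (m∤S ∘ subst (m ∣_) (sym (+-suc v (n + t))))
      ▹ cong (λ v' → pt v' 0 0 t) (sym (+-suc v n))

  lap₀-turn : ∀ {v} → suc v < m → pt v 0 0 1 ↝⟨ suc (3 * (2 * h)) ⟩ pt (suc v) 0 0 (2 * h)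
  lap₀-turn {v} 1+v<m with m≤n⇒∃[o]m+o≡n (s≤s⁻¹ (≤-trans (s≤s (s≤s z≤n)) 1+v<m))
  ... | ℓ , 1+ℓ≡2h = ↝-length length
      ( y-wrap-step₀ (m∤1+v ∘ subst (m ∣_) (+-comm v 1))
                     (0<n<m⇒m∤n z<s (s≤s (≤-trans (s≤s z≤n) (≤-reflexive 1+ℓ≡2h))))
      ▸ drift ℓ z<s z<s (≤-trans (≤-reflexive 1+ℓ≡2h) (n≤1+n _)) (≤-reflexive (cong suc 1+ℓ≡2h)) (inj₁ m∤1+v)
          ▹ cong₂ (pt (suc v) 0) 1+ℓ≡2h (cong suc 1+ℓ≡2h)
      ▸ z-wrap-step₀ (0<n<m⇒m∤n (subst (0 <_) 1+ℓ≡2h z<s) ≤-refl) ∣-refl m∤1+v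
          ▹ pt-cong ≈-refl ≈-refl (+m≈ 1) (+m≈ 1)
      ▸ drift (2 * h) z<s z<s ≤-refl ≤-refl (inj₁ m∤1+v)
          ▹ pt-cong ≈-refl ≈-refl m≈0 m≈0
      ▸ yz-wrap-step₀ m∤1+v
      ▸ drift ℓ z<s z<s (≤-reflexive (cong suc 1+ℓ≡2h)) (≤-trans (≤-reflexive 1+ℓ≡2h) (n≤1+n _)) (inj₁ m∤1+v)
          ▹ pt-cong ≈-refl ≈-refl (≡m⇒≈0 (cong suc 1+ℓ≡2h)) (≡⇒≈ 1+ℓ≡2h) )
    where
    m∤1+v : m ∤ suc v
    m∤1+v = 0<n<m⇒m∤n z<s 1+v<m
    length : 1 + (ℓ + (1 + (2 * h + (1 + ℓ)))) ≡ suc (3 * (2 * h))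
    length = subst (λ H → 1 + (ℓ + (1 + (H + (1 + ℓ)))) ≡ suc (3 * H)) 1+ℓ≡2h (count ℓ)
      where
      count : ∀ ℓ → 1 + (ℓ + (1 + (suc ℓ + (1 + ℓ)))) ≡ suc (3 * suc ℓ)
      count = solve-∀

  ascent : ∀ u → suc u ≤ 2 * h → pt 0 0 0 (suc u) ↝⟨ u * (2 * h) + suc (3 * (2 * h)) ⟩ pt (suc u) 0 0 (2 * h)
  ascent u 1+u≤2h =
    stay ▹ cong (pt 0 0 0) (+-comm 1 u)
    ▸ laps₀-advance u z<s u+1<m (<-trans (n<1+n u) (s≤s 1+u≤2h))
                    (subst (m ∤_) (+-comm 1 u) (0<n<m⇒m∤n z<s (s≤s 1+u≤2h)))
    ▸ lap₀-turn (s≤s 1+u≤2h)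
    where
    u+1<m : u + 1 < m
    u+1<m = s≤s (subst (_≤ 2 * h) (+-comm 1 u) 1+u≤2h)

  round : ∀ u → 2 + u ≤ 2 * h → pt (2 + u) 0 0 (2 * h) ↝⟨ m * m + 1 ⟩ pt (suc u) 0 0 (2 * h)
  round u 2+u≤2h with m≤n⇒∃[o]m+o≡n 2+u≤2h
  ... | w , 2+u+w≡2h = ↝-length length
      ( stay ▹ cong (pt (2 + u) 0 0) (trans (sym 2+u+w≡2h) (+-comm (2 + u) w))
      ▸ laps₀-advance w z<s (≤-reflexive (cong suc (trans (+-comm w (2 + u)) 2+u+w≡2h)))
                      (s≤s (≤-reflexive 2+u+w≡2h)) (≈-∤ (≈-sym S≈1+u) (0<n<m⇒m∤n z<s 1+u<m))
          ▹ cong (λ v → pt v 0 0 (2 + u)) 2+u+w≡2h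
      ▸ lap₀-carry z<s (s≤s 2+u≤2h)
      ▸ ascent u (≤-trans (n≤1+n _) 2+u≤2h) )
    where
    1+u<m : suc u < m
    1+u<m = s≤s (≤-trans (n≤1+n _) 2+u≤2h)
    S≈1+u : 2 + u + (w + (2 + u)) ≈ suc u
    S≈1+u = ≈-trans (≡⇒≈ (trans (regroup u w) (cong (λ H → suc u + suc H) 2+u+w≡2h))) (+m≈ (suc u))
      where
      regroup : ∀ u w → 2 + u + (w + (2 + u)) ≡ suc u + suc (2 + u + w)
      regroup = solve-∀
    length : w * (2 * h) + (m + (u * (2 * h) + suc (3 * (2 * h)))) ≡ m * m + 1
    length = subst (λ H → w * H + (suc H + (u * H + suc (3 * H))) ≡ suc H * suc H + 1) 2+u+w≡2h (count u w)
      where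
      count : ∀ u w → w * (2 + u + w) + (suc (2 + u + w) + (u * (2 + u + w) + suc (3 * (2 + u + w))))
                      ≡ suc (2 + u + w) * suc (2 + u + w) + 1
      count = solve-∀

  rounds : ∀ n → suc n ≤ 2 * h → pt (suc n) 0 0 (2 * h) ↝⟨ n * (m * m + 1) ⟩ pt 1 0 0 (2 * h)
  rounds zero    _        = stay
  rounds (suc n) 2+n≤2h = round n 2+n≤2h ▸ rounds n (≤-trans (n≤1+n _) 2+n≤2h)

  -- h + 1 is the inverse of 2 modulo m.
  m∤n⇒m∤2*n : ∀ {e} → m ∤ e → m ∤ 2 * e
  m∤n⇒m∤2*n {e} m∤e m∣2e = m∤e (∣m+n∣m⇒∣n (subst (m ∣_) (halve h e) (∣n⇒∣m*n (suc h) m∣2e)) (n∣m*n e))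
    where
    halve : ∀ h e → suc h * (2 * e) ≡ e * suc (2 * h) + e
    halve = solve-∀

  ∤-odd-run : ∀ {d n} → 0 < d → d + 2 * n ≤ m → ∀ j → j < n → m ∤ d + 2 * j
  ∤-odd-run {d} 0<d d+2n≤m j j<n =
    0<n<m⇒m∤n (≤-trans 0<d (m≤m+n d _)) (<-≤-trans (+-monoʳ-< d (*-monoʳ-< 2 j<n)) d+2n≤m)

  ∤-even-run : ∀ {d n} → 0 < d → d + n ≤ m → ∀ j → j < n → m ∤ 2 * (d + j)
  ∤-even-run {d} 0<d d+n≤m j j<n =
    m∤n⇒m∤2*n (0<n<m⇒m∤n (≤-trans 0<d (m≤m+n d j)) (<-≤-trans (+-monoʳ-< d j<n) d+n≤m))

  wpt≡pt : ∀ (a b : Fin m) z → m ∣ toℕ a + toℕ b + z → wpt a b ≡ pt (toℕ a) (toℕ b) 0 z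
  wpt≡pt a b z m∣S = sym (trans (pt≡wpt {toℕ a} {toℕ b} {z} m∣S) (cong₂ wpt (⟪toℕ⟫ a) (⟪toℕ⟫ b)))

  FirstReturn-cong : ∀ {ℓ ℓ' w₁ w₂ w₁' w₂'} → ℓ ≡ ℓ' → w₁ ≡ w₁' → w₂ ≡ w₂' →
                     FirstReturn {m} ℓ w₁ w₂ → FirstReturn {m} ℓ' w₁' w₂'
  FirstReturn-cong refl refl refl r = r

  module PartI (a b : Fin m) (a+b≢0 : ¬ (a +ₘ b ≡ 0ₘ)) (1+b<m : suc (toℕ b) < m) where

    A B s : ℕ
    A = toℕ a
    B = toℕ b
    s = toℕ (a +ₘ b)

    A+B≈s : A + B ≈ s
    A+B≈s = ≈-sym (toℕ-⟪⟫≈ (A + B))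

    0<s : 0 < s
    0<s = n≢0⇒n>0 λ s≡0 → a+b≢0 (toℕ-injective s≡0)

    s<m : s < m
    s<m = toℕ<n (a +ₘ b)

    ∤-via : ∀ {n} k → n ≡ A + B + k → m ∤ s + k → m ∤ n
    ∤-via k e = ≈-∤ (≈-sym (≈-trans (≡⇒≈ e) (+-≈ A+B≈s ≈-refl)))

    ∣-via : ∀ {n} k → n ≡ A + B + k → m ∣ s + k → m ∣ n
    ∣-via k e = ≈-∣ (≈-sym (≈-trans (≡⇒≈ e) (+-≈ A+B≈s ≈-refl)))

    n₀ z₀ : ℕ
    n₀ = pred s
    z₀ = m ∸ s

    1+n₀≡s : suc n₀ ≡ s
    1+n₀≡s = suc-pred s {{>-nonZero 0<s}}

    s+z₀≡m : s + z₀ ≡ m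
    s+z₀≡m = m+[n∸m]≡n (<⇒≤ s<m)

    z₀+n₀≡2h : z₀ + n₀ ≡ 2 * h
    z₀+n₀≡2h =
      suc-injective (trans (sym (+-suc z₀ n₀)) (trans (cong (z₀ +_) 1+n₀≡s) (trans (+-comm z₀ s) s+z₀≡m)))

    m∤1+B : m ∤ suc B
    m∤1+B = 0<n<m⇒m∤n z<s 1+b<m

    climb : G {m} (wpt a b) ↝⟨ 2 * h + (n₀ * m + m) ⟩ pt (A + s) (suc B) 0 0
    climb =
      stay ▹ cong (G {m}) (wpt≡pt a b z₀ m∣S₀)
           ▹ exit-step {A} {B} {z₀} m∣S₀ (0<n<m⇒m∤n (m<n⇒0<n∸m s<m) z₀<m)
      ▸ tail (m<n⇒0<n∸m s<m) z₀<m m∤1+B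
      ▸ laps-advance n₀ (subst (_< m) (sym z₀+n₀≡2h) ≤-refl) m∤Sᵢ m∤1+B
          ▹ cong₂ (λ v z → pt v (suc B) 0 z) (trans (sym (+-suc A n₀)) (cong (A +_) 1+n₀≡s)) z₀+n₀≡2h
      ▸ lap-reset (∤-via (s + m) (regroup₁ A B s h) (≈-∤ (≈-sym (≈-trans (≡⇒≈ (double s m)) (+m≈ (2 * s))))
                                                          (m∤n⇒m∤2*n (0<n<m⇒m∤n 0<s s<m)))) m∤1+B
      where
      z₀<m : z₀ < m
      z₀<m = ∸-monoʳ-< 0<s (<⇒≤ s<m)
      m∣S₀ : m ∣ A + B + z₀
      m∣S₀ = ∣-via z₀ refl (subst (m ∣_) (sym s+z₀≡m) ∣-refl)
      m∤Sᵢ : ∀ i → i < n₀ → m ∤ suc A + suc B + z₀ + 2 * i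
      m∤Sᵢ i i<n₀ = ∤-via (2 + z₀ + 2 * i) (regroup₂ A B z₀ i)
        (≈-∤ (≈-sym (≈-trans (≡⇒≈ (trans (regroup₃ s z₀ i) (cong (2 * suc i +_) s+z₀≡m))) (+m≈ (2 * suc i))))
             (∤-even-run z<s (≤-trans (≤-reflexive 1+n₀≡s) (<⇒≤ s<m)) i i<n₀))
        where
        regroup₂ : ∀ A B z i → suc A + suc B + z + 2 * i ≡ A + B + (2 + z + 2 * i)
        regroup₂ = solve-∀
        regroup₃ : ∀ s z i → s + (2 + z + 2 * i) ≡ 2 * suc i + (s + z)
        regroup₃ = solve-∀
      regroup₁ : ∀ A B s h → A + s + suc B + 2 * h ≡ A + B + (s + suc (2 * h))
      regroup₁ = solve-∀
      double : ∀ s m → s + (s + m) ≡ 2 * s + m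
      double = solve-∀

    regroupⱼ : ∀ A B s j → A + s + suc B + 0 + 2 * j ≡ A + B + (s + suc (2 * j))
    regroupⱼ = solve-∀

    regroupₙ : ∀ A B s n → A + s + n + suc B + n ≡ A + B + (s + suc (2 * n))
    regroupₙ = solve-∀

    odd : ∀ s j → s + (s + suc (2 * j)) ≡ suc (2 * s) + 2 * j
    odd = solve-∀

    laps-count : ∀ M n₀ n → M + (n₀ * M + M) + n * M ≡ (suc n₀ + n + 1) * M
    laps-count = solve-∀

    below : s < h → FirstReturn {m} ((h + 1) * m) (wpt a b) (wpt (addℕ a h) (addℕ b 1))
    below s<h with m≤n⇒∃[o]m+o≡n s<h
    ... | n' , 1+s+n'≡h = FirstReturn-cong length refl target
        (firstReturn m∣S (0<n<m⇒m∤n z<s n<m)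
          (climb ▸ laps-advance n n<m (λ j j<n → ∤-via (s + suc (2 * j)) (regroupⱼ A B s j)
                                          (subst (m ∤_) (sym (odd s j)) (∤-odd-run z<s (≤-reflexive run) j j<n))) m∤1+B))
      where
      n : ℕ
      n = suc n'
      s+n≡h : s + n ≡ h
      s+n≡h = trans (+-suc s n') 1+s+n'≡h
      n<m : n < m
      n<m = s≤s (≤-trans (m+n≤o⇒n≤o s (≤-reflexive s+n≡h)) (m≤m+n h _))
      run : suc (2 * s) + 2 * n ≡ m
      run = cong suc (trans (sym (*-distribˡ-+ 2 s n)) (cong (2 *_) s+n≡h))
      m∣S : m ∣ A + s + n + suc B + n
      m∣S = ∣-via (s + suc (2 * n)) (regroupₙ A B s n) (subst (m ∣_) (sym (trans (odd s n) run)) ∣-refl)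
      target : wpt ⟪ A + s + n ⟫ ⟪ suc B ⟫ ≡ wpt (addℕ a h) (addℕ b 1)
      target = cong₂ wpt (cong ⟪_⟫ (trans (+-assoc A s n) (cong (A +_) s+n≡h))) (cong ⟪_⟫ (+-comm 1 B))
      length : suc (2 * h + (n₀ * m + m) + n * m) ≡ (h + 1) * m
      length = trans (laps-count m n₀ n) (cong (λ t → (t + 1) * m) (trans (cong (_+ n) 1+n₀≡s) s+n≡h))

    middle : s ≡ h → FirstReturn {m} (2 * (h + 1) * m) (wpt a b) (wpt a (addℕ b 1))
    middle s≡h = FirstReturn-cong length refl target
        (firstReturn m∣S (0<n<m⇒m∤n 0<h (s≤s (m≤m+n h _)))
          (climb ▸ lap-zero m∣v+c m∤1+B
           ▸ laps-advance h (s≤s (m≤m+n h _))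
                          (λ j j<h → ∤-via (2 + s + 2 * j) (regroup₁ A B s j) (m∤Sⱼ j j<h)) m∤1+B))
      where
      0<h : 0 < h
      0<h = subst (0 <_) s≡h 0<s
      s+1+s≡m : s + suc s ≡ m
      s+1+s≡m = trans (twice s) (cong (λ t → suc (2 * t)) s≡h)
        where
        twice : ∀ s → s + suc s ≡ suc (2 * s)
        twice = solve-∀
      m∣v+c : m ∣ A + s + suc B
      m∣v+c = ∣-via (suc s) (regroup₀ A B s) (subst (m ∣_) (sym s+1+s≡m) ∣-refl)
        where
        regroup₀ : ∀ A B s → A + s + suc B ≡ A + B + suc s
        regroup₀ = solve-∀
      regroup₁ : ∀ A B s j → suc (A + s) + suc B + 0 + 2 * j ≡ A + B + (2 + s + 2 * j)
      regroup₁ = solve-∀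
      m∤Sⱼ : ∀ j → j < h → m ∤ s + (2 + s + 2 * j)
      m∤Sⱼ j j<h = ≈-∤ (≈-sym (≈-trans (≡⇒≈ e) (+m≈ (1 + 2 * j)))) (∤-odd-run {1} z<s ≤-refl j j<h)
        where
        e : s + (2 + s + 2 * j) ≡ 1 + 2 * j + m
        e = trans (shuffle s j) (cong (1 + 2 * j +_) s+1+s≡m)
          where
          shuffle : ∀ s j → s + (2 + s + 2 * j) ≡ 1 + 2 * j + (s + suc s)
          shuffle = solve-∀
      m∣S : m ∣ suc (A + s) + h + suc B + h
      m∣S = ∣-via (2 + s + 2 * h) (regroup₂ A B s h) (subst (m ∣_) (sym e) (∣m∣n⇒∣m+n ∣-refl ∣-refl))
        where
        regroup₂ : ∀ A B s h → suc (A + s) + h + suc B + h ≡ A + B + (2 + s + 2 * h)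
        regroup₂ = solve-∀
        e : s + (2 + s + 2 * h) ≡ m + m
        e = trans (shuffle s h) (cong (_+ m) s+1+s≡m)
          where
          shuffle : ∀ s h → s + (2 + s + 2 * h) ≡ s + suc s + suc (2 * h)
          shuffle = solve-∀
      target : wpt ⟪ suc (A + s) + h ⟫ ⟪ suc B ⟫ ≡ wpt a (addℕ b 1)
      target = cong₂ wpt (trans (⟪⟫-cong (≈-trans (≡⇒≈ e) (+m≈ A))) (⟪toℕ⟫ a)) (cong ⟪_⟫ (+-comm 1 B))
        where
        e : suc (A + s) + h ≡ A + m
        e = trans (cong (λ t → suc (A + t) + h) s≡h) (shuffle A h)
          where
          shuffle : ∀ A h → suc (A + h) + h ≡ A + suc (2 * h)
          shuffle = solve-∀
      length : suc (2 * h + (n₀ * m + m) + (m + h * m)) ≡ 2 * (h + 1) * m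
      length = trans (cong (λ t → m + (n₀ * m + m) + (m + t * m)) (sym 1+n₀≡h))
                     (trans (count m n₀) (cong (λ t → 2 * (t + 1) * m) 1+n₀≡h))
        where
        1+n₀≡h : suc n₀ ≡ h
        1+n₀≡h = trans 1+n₀≡s s≡h
        count : ∀ M n₀ → M + (n₀ * M + M) + (M + suc n₀ * M) ≡ 2 * (suc n₀ + 1) * M
        count = solve-∀

    above : h + 1 ≤ s → s ≤ 2 * h → FirstReturn {m} ((3 * h + 2) * m) (wpt a b) (wpt (addℕ a h) (addℕ b 1))
    above h+1≤s s≤2h with m≤n⇒∃[o]m+o≡n h+1≤s
    ... | k , h+1+k≡s
      with m≤n⇒∃[o]m+o≡n (m+n≤o⇒n≤o h (subst (_≤ 2 * h) (trans (sym h+1+k≡s) (+-assoc h 1 k)) s≤2h))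
    ... | n' , 1+k+n'≡2h = FirstReturn-cong length refl target
        (firstReturn m∣S (0<n<m⇒m∤n z<s n<m)
          (climb ▸ laps-advance n n<m (λ j j<n → ∤-via (s + suc (2 * j)) (regroupⱼ A B s j) (m∤Sⱼ j j<n)) m∤1+B))
      where
      n : ℕ
      n = suc n'
      1+k+n≡m : suc k + n ≡ m
      1+k+n≡m = cong suc (trans (+-suc k n') 1+k+n'≡2h)
      n<m : n < m
      n<m = ≤-trans (s≤s (m≤n+m n k)) (≤-reflexive 1+k+n≡m)
      excess : ∀ j → suc (2 * s) + 2 * j ≡ 2 * (suc k + j) + m
      excess j = trans (cong (λ t → suc (2 * t) + 2 * j) (sym h+1+k≡s)) (shuffle h k j)
        where
        shuffle : ∀ h k j → suc (2 * (h + 1 + k)) + 2 * j ≡ 2 * (suc k + j) + suc (2 * h)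
        shuffle = solve-∀
      m∤Sⱼ : ∀ j → j < n → m ∤ s + (s + suc (2 * j))
      m∤Sⱼ j j<n = ≈-∤ (≈-sym (≈-trans (≡⇒≈ (trans (odd s j) (excess j))) (+m≈ _)))
                       (∤-even-run z<s (≤-reflexive 1+k+n≡m) j j<n)
      m∣S : m ∣ A + s + n + suc B + n
      m∣S = ∣-via (s + suc (2 * n)) (regroupₙ A B s n)
              (subst (m ∣_) (sym (trans (odd s n) (trans (excess n) (cong (λ t → 2 * t + m) 1+k+n≡m))))
                     (∣m∣n⇒∣m+n (∣n⇒∣m*n 2 ∣-refl) ∣-refl))
      target : wpt ⟪ A + s + n ⟫ ⟪ suc B ⟫ ≡ wpt (addℕ a h) (addℕ b 1)
      target = cong₂ wpt (⟪⟫-cong (≈-trans (≡⇒≈ e) (+m≈ (A + h)))) (cong ⟪_⟫ (+-comm 1 B))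
        where
        e : A + s + n ≡ A + h + m
        e = trans (cong (λ t → A + t + n) (sym h+1+k≡s)) (trans (shuffle A h k n) (cong (A + h +_) 1+k+n≡m))
          where
          shuffle : ∀ A h k n → A + (h + 1 + k) + n ≡ A + h + (suc k + n)
          shuffle = solve-∀
      length : suc (2 * h + (n₀ * m + m) + n * m) ≡ (3 * h + 2) * m
      length = trans (laps-count m n₀ n) (cong (_* m) e)
        where
        e : suc n₀ + n + 1 ≡ 3 * h + 2
        e = trans (cong (λ t → t + n + 1) (trans 1+n₀≡s (sym h+1+k≡s)))
                  (trans (shuffle h k n) (trans (cong (λ t → h + t + 1) 1+k+n≡m) (tally h)))
          where
          shuffle : ∀ h k n → h + 1 + k + n + 1 ≡ h + (suc k + n) + 1
          shuffle = solve-∀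
          tally : ∀ h → h + suc (2 * h) + 1 ≡ 3 * h + 2
          tally = solve-∀

  top-row : ∀ (a : Fin m) z → m ∣ toℕ a + 2 * h + z → wpt a (fromℕ (2 * h)) ≡ pt (toℕ a) (2 * h) 0 z
  top-row a z m∣S = trans (wpt≡pt a (fromℕ (2 * h)) z (subst (λ t → m ∣ toℕ a + t + z) (sym 2h≡) m∣S))
                          (cong (λ t → pt (toℕ a) t 0 z) 2h≡)
    where
    2h≡ : toℕ (fromℕ (2 * h)) ≡ 2 * h
    2h≡ = toℕ-fromℕ (2 * h)

  opening₀ : 0 < h → G {m} (pt 0 (2 * h) 0 1) ↝⟨ 2 * h + (1 + 2 * h) ⟩ pt 0 0 0 (2 * h)
  opening₀ 0<h =
    stay ▹ exit-step {0} {2 * h} {1} (subst (m ∣_) (+-comm 1 (2 * h)) ∣-refl)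
                                     (0<n<m⇒m∤n z<s (s≤s (≤-trans 0<h (m≤m+n h _))))
         ▹ pt-cong ≈-refl m≈0 ≈-refl ≈-refl
    ▸ drift₄ (2 * h) z<s ≤-refl
        ▹ pt-cong ≈-refl ≈-refl m≈0 (≈-trans (≡⇒≈ (double h)) (≈-trans (+m≈ m) m≈0))
    ▸ null-step
    ▸ drift₄ (2 * h) z<s ≤-refl ▹ pt-cong ≈-refl ≈-refl m≈0 (≈-trans (≡⇒≈ (double-1 h)) (+m≈ (2 * h)))
    where
    double : ∀ h → 2 + 2 * (2 * h) ≡ suc (2 * h) + suc (2 * h)
    double = solve-∀
    double-1 : ∀ h → 1 + 2 * (2 * h) ≡ 2 * h + suc (2 * h)
    double-1 = solve-∀

  top-zero : 0 < h → FirstReturn {m} (m ^ 3 ∸ (m ∸ 1) * (m ∸ 2)) (wpt 0ₘ (fromℕ (2 * h))) (wpt 1ₘ 0ₘ)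
  top-zero 0<h with m≤n⇒∃[o]m+o≡n (≤-trans 0<h (m≤m+n h _))
  ... | ℓ , 1+ℓ≡2h = FirstReturn-cong length (sym (top-row 0ₘ 1 (subst (m ∣_) (+-comm 1 (2 * h)) ∣-refl))) refl
      (firstReturn {v = 1} {0} {2 * h} ∣-refl (0<n<m⇒m∤n (≤-trans 0<h (m≤m+n h _)) ≤-refl)
        ( opening₀ 0<h
        ▸ stay ▹ cong (pt 0 0 0) (sym 1+ℓ≡2h)
        ▸ ascent ℓ (≤-reflexive 1+ℓ≡2h)
        ▸ rounds ℓ (≤-reflexive 1+ℓ≡2h) ))
    where
    L : ℕ
    L = 2 * h + (1 + 2 * h) + (ℓ * (2 * h) + suc (3 * (2 * h)) + ℓ * (m * m + 1))
    total : suc L + 2 * h * ℓ ≡ m ^ 3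
    total = subst (λ H → suc (H + (1 + H) + (ℓ * H + suc (3 * H) + ℓ * (suc H * suc H + 1))) + H * ℓ ≡ suc H ^ 3)
                  1+ℓ≡2h (count ℓ)
      where
      count : ∀ n → suc (suc n + (1 + suc n) + (n * suc n + suc (3 * suc n) + n * (suc (suc n) * suc (suc n) + 1)))
                    + suc n * n ≡ suc (suc n) * (suc (suc n) * (suc (suc n) * 1))
      count = solve-∀
    length : suc L ≡ m ^ 3 ∸ (m ∸ 1) * (m ∸ 2)
    length = begin
      suc L                           ≡⟨ m+n∸n≡m (suc L) (2 * h * ℓ) ⟨
      suc L + 2 * h * ℓ ∸ 2 * h * ℓ   ≡⟨ cong (_∸ 2 * h * ℓ) total ⟩
      m ^ 3 ∸ 2 * h * ℓ               ≡⟨ cong (λ t → m ^ 3 ∸ 2 * h * (t ∸ 1)) 1+ℓ≡2h ⟩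
      m ^ 3 ∸ (m ∸ 1) * (m ∸ 2)       ∎
      where open ≡-Reasoning

  top-other : 0 < h → ∀ (a : Fin m) → ¬ (a ≡ 0ₘ) → ¬ (a ≡ 1ₘ) →
              FirstReturn {m} (m ∸ 1) (wpt a (fromℕ (2 * h))) (wpt a 0ₘ)
  top-other 0<h a a≢0 a≢1 with m≤n⇒∃[o]m+o≡n (toℕ<n a) | m≤n⇒∃[o]m+o≡n (≤-trans 0<h (m≤m+n h _))
  ... | t' , 1+A+t'≡m | ℓ , 1+ℓ≡2h =
    FirstReturn-cong 1+ℓ≡2h (sym (top-row a t₀ m∣S₀)) (cong₂ wpt (⟪toℕ⟫ a) refl)
      (firstReturn {v = A} {0} {t} m∣S (0<n<m⇒m∤n z<s (≤-trans (n≤1+n _) 2+t≤m))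
        ( stay ▹ exit-step {A} {2 * h} {t₀} m∣S₀ (0<n<m⇒m∤n z<s 2+t≤m) ▹ pt-cong ≈-refl m≈0 ≈-refl ≈-refl
        ▸ tail₀ 1+ℓ≡2h z<s 2+t≤m (0<n<m⇒m∤n (≤-trans (s≤s z≤n) 2≤A) (toℕ<n a)) ))
    where
    A t t₀ : ℕ
    A = toℕ a
    t = suc t'
    t₀ = suc t
    A+t≡m : A + t ≡ m
    A+t≡m = trans (+-suc A t') 1+A+t'≡m
    2≤A : 2 ≤ A
    2≤A with toℕ a in eq
    ... | zero        = contradiction (toℕ-injective eq) a≢0
    ... | suc zero    = contradiction (toℕ-injective (trans eq (sym toℕ-1ₘ))) a≢1
      where
      toℕ-1ₘ : toℕ (1ₘ {m}) ≡ 1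
      toℕ-1ₘ = trans (toℕ-⟪⟫ 1) (m<n⇒m%n≡m (s≤s (≤-trans 0<h (m≤m+n h _))))
    ... | suc (suc _) = s≤s (s≤s z≤n)
    2+t≤m : 2 + t ≤ m
    2+t≤m = ≤-trans (+-monoˡ-≤ t 2≤A) (≤-reflexive A+t≡m)
    m∣S₀ : m ∣ A + 2 * h + t₀
    m∣S₀ = subst (m ∣_) (sym (trans (shuffle A (2 * h) t) (cong (_+ m) A+t≡m))) (∣m∣n⇒∣m+n ∣-refl ∣-refl)
      where
      shuffle : ∀ A H t → A + H + suc t ≡ A + t + suc H
      shuffle = solve-∀
    m∣S : m ∣ A + 0 + t
    m∣S = subst (m ∣_) (sym (trans (cong (_+ t) (+-identityʳ A)) A+t≡m)) ∣-refl

mainTheorem5 : (h : ℕ) → 2 ≤ h →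
    (a b : Fin (suc (2 * h))) → ¬ (a +ₘ b ≡ 0ₘ) →
    -- (I) 0 ≤ b ≤ m - 2, with s = a + b represented in {1, ..., 2h}
    ((toℕ b ≤ suc (2 * h) ∸ 2 →
        ((1 ≤ toℕ (a +ₘ b) → toℕ (a +ₘ b) < h →
            FirstReturn ((h + 1) * suc (2 * h)) (wpt a b) (wpt (addℕ a h) (addℕ b 1)))
        × (toℕ (a +ₘ b) ≡ h →
            FirstReturn (2 * (h + 1) * suc (2 * h)) (wpt a b) (wpt a (addℕ b 1)))
        × (h + 1 ≤ toℕ (a +ₘ b) → toℕ (a +ₘ b) ≤ 2 * h →
            FirstReturn ((3 * h + 2) * suc (2 * h)) (wpt a b) (wpt (addℕ a h) (addℕ b 1)))))
    -- (II) b = m - 1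
    × (b ≡ fromℕ (2 * h) →
        (a ≡ 0ₘ →
            FirstReturn (suc (2 * h) ^ 3 ∸ (suc (2 * h) ∸ 1) * (suc (2 * h) ∸ 2))
              (wpt a b) (wpt (1ₘ) 0ₘ))
        × (¬ (a ≡ 0ₘ) → ¬ (a ≡ 1ₘ) →
            FirstReturn (suc (2 * h) ∸ 1) (wpt a b) (wpt a 0ₘ))))
mainTheorem5 h 2≤h a b a+b≢0 =
    -- the hypothesis 1 ≤ s of the first case already follows from a + b ≢ 0
    (λ b≤m-2 → let open PartI a b a+b≢0 (1+b<m b≤m-2) in (λ _ → below) , middle , above)
  , λ { refl → (λ { refl → top-zero 0<h }) , top-other 0<h a }
  where
  open Orbit h
  0<h : 0 < h
  0<h = ≤-trans (s≤s z≤n) 2≤h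
  1+b<m : toℕ b ≤ m ∸ 2 → suc (toℕ b) < m
  1+b<m b≤m-2 = s≤s (≤-trans (s≤s b≤m-2) (≤-reflexive (m+[n∸m]≡n (≤-trans 0<h (m≤m+n h _)))))
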